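{- Let $(\mathcal C,\mathcal S)$ be a conjunctive algebra. Then: 1. $a\multimap a\in\mathcal S$ for all $a\in\mathbb C$. 2. $(a_1 ⅋\dots⅋ a_k)\multimap(a_{\sigma(1)}⅋\dots⅋a_{\sigma(k)})\in\mathcal S$ for all $a_1,\dots,a_k\in\mathbb C$ and every permutation $\sigma$ of $k$ elements. 3. For all $a,b,g$: $g⅋a\preccurlyeq g⅋(a\vee b)$, hence $(g⅋a)\multimap(g⅋(a\vee b))\in\mathcal S$. 4. For all $a,b,g,d$: $(g⅋a)\otimes(b⅋d)\multimap g⅋((a\otimes b)⅋d)\in\mathcal S$ and $(g⅋a)\multimap(b⅋d)\multimap g⅋((a\otimes b)⅋d)\in\mathcal S$. 5. For all $a,g,d$: $(g⅋a)\multimap(a^\perp⅋d)\multimap(g⅋d)\in\mathcal S$. 6. $\mathbf 1\in\mathcal S$. 7. For all $g,b\in\mathbb C$ and $F\in\mathbb C^{\mathbb C}$: $g⅋F(b)\preccurlyeq g⅋\exists F$.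
   Context: A conjunctive structure $(\mathbb C,\otimes,(\ )^\perp,\preccurlyeq)$: $(\mathbb C,\bigvee,\preccurlyeq)$ complete join-semilattice (hence complete lattice with meets $\bigwedge$), $\otimes$ monotone, $(\ )^\perp$ antimonotone and involutive, $\otimes$ distributes over arbitrary joins on both sides, $(\bigvee\mathfrak B)^\perp=\bigwedge_{b\in\mathfrak B}b^\perp$. Define $a⅋b:=(a^\perp\otimes b^\perp)^\perp$, $a\multimap b:=(a\otimes b^\perp)^\perp$ (right-associative), $\exists F:=\bigvee_{a}F(a)$. A conjunctive algebra adds a unit $\mathbf 1$ and $\mathcal S\subseteq\mathbb C$ containing $\mathbf 1$ and $S_3:=\bigwedge_{a,b}(a\otimes b\multimap b\otimes a)$, $S_4:=\bigwedge_{a,b,c}(a\multimap b)\multimap(b\multimap c)\multimap a\multimap c$, $S_5:=\bigwedge_{a,b,c}((a\otimes b)\otimes c)\multimap(a\otimes(b\otimes c))$, $S_6:=\bigwedge_a a\multimap(\mathbf 1\otimes a)$, $S_7:=\bigwedge_a(\mathbf 1\otimes a)\multimap a$, upward closed, closed under modus ponens, under $a\multimap b\in\mathcal S\Rightarrow a\otimes c\multimap b\otimes c\in\mathcal S$, and under $a\multimap b\in\mathcal S\Rightarrow b^\perp\multimap a^\perp\in\mathcal S$. -}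

module Defs where

open import Level using (Level; suc)
open import Data.Product using (Σ; _×_; _,_)
open import Data.Sum using (_⊎_)
open import Data.Nat using (ℕ; zero) renaming (suc to sucℕ)
open import Data.Fin using (Fin) renaming (zero to fzero; suc to fsuc)
open import Relation.Binary.PropositionalEquality using (_≡_)
open import Relation.Binary.Structures using (IsPartialOrder)

Image : ∀ {c} {I C : Set c} → (I → C) → C → Set c
Image {I = I} f x = Σ I (λ i → f i ≡ x)

record ConjunctiveStructure (c : Level) : Set (suc c) where
  infixr 6 _⊗_
  infix 4 _≼_
  infix 8 _⊥
  field
    Carrier : Set c
    _≼_ : Carrier → Carrier → Set c
    isPartialOrder : IsPartialOrder _≡_ _≼_
    ⋁ : (Carrier → Set c) → Carrier
    ⋁-upper : ∀ (B : Carrier → Set c) a → B a → a ≼ ⋁ B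
    ⋁-least : ∀ (B : Carrier → Set c) u → (∀ a → B a → a ≼ u) → ⋁ B ≼ u
    _⊗_ : Carrier → Carrier → Carrier
    _⊥ : Carrier → Carrier
    ⊗-mono : ∀ {a a′ b b′} → a ≼ a′ → b ≼ b′ → a ⊗ b ≼ a′ ⊗ b′
    ⊥-antimono : ∀ {a b} → a ≼ b → b ⊥ ≼ a ⊥
    ⊥-involutive : ∀ a → (a ⊥) ⊥ ≡ a
    ⊗-distribʳ-⋁ : ∀ (B : Carrier → Set c) b →
      (⋁ B) ⊗ b ≡ ⋁ (Image {I = Σ Carrier B} (λ p → Σ.proj₁ p ⊗ b))
    ⊗-distribˡ-⋁ : ∀ b (B : Carrier → Set c) →
      b ⊗ (⋁ B) ≡ ⋁ (Image {I = Σ Carrier B} (λ p → b ⊗ Σ.proj₁ p))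

  ⋀ : (Carrier → Set c) → Carrier
  ⋀ B = ⋁ (λ x → ∀ a → B a → x ≼ a)

  field
    ⊥-⋁ : ∀ (B : Carrier → Set c) →
      (⋁ B) ⊥ ≡ ⋀ (Image {I = Σ Carrier B} (λ p → Σ.proj₁ p ⊥))

  infixr 6 _⅋_
  infixr 4 _⊸_

  _⅋_ : Carrier → Carrier → Carrier
  a ⅋ b = ((a ⊥) ⊗ (b ⊥)) ⊥

  _⊸_ : Carrier → Carrier → Carrier
  a ⊸ b = (a ⊗ (b ⊥)) ⊥

  _∨_ : Carrier → Carrier → Carrier
  a ∨ b = ⋁ (λ x → (x ≡ a) ⊎ (x ≡ b))

  ∃ᶜ : (Carrier → Carrier) → Carrier
  ∃ᶜ F = ⋁ (Image F)

  -- a₁ ⅋ … ⅋ a_k  (k = n+1 ≥ 1), bracketed to the right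
  ⅋ⁿ : ∀ {n} → (Fin (sucℕ n) → Carrier) → Carrier
  ⅋ⁿ {zero} a = a fzero
  ⅋ⁿ {sucℕ n} a = a fzero ⅋ ⅋ⁿ (λ i → a (fsuc i))

record ConjunctiveAlgebra (c : Level) : Set (suc c) where
  field
    structure : ConjunctiveStructure c
  open ConjunctiveStructure structure public
  field
    𝟏 : Carrier
    𝒮 : Carrier → Set c

  S₃ : Carrier
  S₃ = ⋀ (Image {I = Carrier × Carrier}
          (λ { (a , b) → a ⊗ b ⊸ b ⊗ a }))
  S₄ : Carrier
  S₄ = ⋀ (Image {I = Carrier × Carrier × Carrier}
          (λ { (a , b , d) → (a ⊸ b) ⊸ (b ⊸ d) ⊸ a ⊸ d }))
  S₅ : Carrier
  S₅ = ⋀ (Image {I = Carrier × Carrier × Carrier}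
          (λ { (a , b , d) → ((a ⊗ b) ⊗ d) ⊸ (a ⊗ (b ⊗ d)) }))
  S₆ : Carrier
  S₆ = ⋀ (Image (λ a → a ⊸ (𝟏 ⊗ a)))
  S₇ : Carrier
  S₇ = ⋀ (Image (λ a → (𝟏 ⊗ a) ⊸ a))

  field
    𝟏∈𝒮 : 𝒮 𝟏
    S₃∈𝒮 : 𝒮 S₃
    S₄∈𝒮 : 𝒮 S₄
    S₅∈𝒮 : 𝒮 S₅
    S₆∈𝒮 : 𝒮 S₆
    S₇∈𝒮 : 𝒮 S₇
    𝒮-upward : ∀ {a b} → 𝒮 a → a ≼ b → 𝒮 b
    𝒮-mp : ∀ {a b} → 𝒮 a → 𝒮 (a ⊸ b) → 𝒮 b
    𝒮-⊗ : ∀ {a b} d → 𝒮 (a ⊸ b) → 𝒮 (a ⊗ d ⊸ b ⊗ d)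
    𝒮-contra : ∀ {a b} → 𝒮 (a ⊸ b) → 𝒮 ((b ⊥) ⊸ (a ⊥))

-- Read x ⊢ y := 𝒮 (x ⊸ y) as entailment. Axioms S₄, S₆, S₇ make it a preorder, S₃, S₅ and the
-- closure of 𝒮 under ⊗ make ⊗ commutative, associative and monotone up to ⊢, and closure under
-- contraposition transports all of this to a ⅋ b = (a ⊥ ⊗ b ⊥) ⊥. Since x ⊢ y is literally the refutability
-- 𝒮 ((x ⊗ y ⊥) ⊥) of x ⊗ y ⊥, the ⅋-rules of the proposition reduce to linear distributivity
-- (x ⅋ y) ⊗ z ⊢ x ⅋ (y ⊗ z) and to dropping the refutable ⅋-summand a ⊗ a ⊥.
module Submission where

open import Defs
import Data.Nat
open import Data.Nat using (zero; suc)
open import Data.Product using (_×_; _,_)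
open import Data.Sum using (inj₁)
open import Data.Fin using (Fin; punchIn) renaming (zero to fzero; suc to fsuc)
open import Data.Fin.Permutation using (Permutation′; _⟨$⟩ʳ_; remove; punchIn-permute)
open import Function using (_∘_)
open import Relation.Binary.Bundles using (Preorder)
open import Relation.Binary.Structures using (IsPartialOrder)
open import Relation.Binary.PropositionalEquality
  using (_≡_; refl; sym; cong; cong₂; isEquivalence)
import Relation.Binary.Reasoning.Preorder as PreorderReasoning

module ConjunctiveAlgebraProperties {c} (A : ConjunctiveAlgebra c) where
  open ConjunctiveAlgebra A

  infix 3 _⊢_
  _⊢_ : Carrier → Carrier → Set c
  x ⊢ y = 𝒮 (x ⊸ y)

  Refutable : Carrier → Set c
  Refutable x = 𝒮 (x ⊥)

  ≼-refl : ∀ {x} → x ≼ x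
  ≼-refl = IsPartialOrder.refl isPartialOrder

  ⋀-lower : ∀ (B : Carrier → Set c) {a} → B a → ⋀ B ≼ a
  ⋀-lower B Ba = ⋁-least _ _ (λ x x≼B → x≼B _ Ba)

  𝒮-⋀ : ∀ (B : Carrier → Set c) {a} → 𝒮 (⋀ B) → B a → 𝒮 a
  𝒮-⋀ B s Ba = 𝒮-upward s (⋀-lower B Ba)

  ⊢-trans : ∀ {x y z} → x ⊢ y → y ⊢ z → x ⊢ z
  ⊢-trans {x} {y} {z} x⊢y y⊢z = 𝒮-mp y⊢z (𝒮-mp x⊢y (𝒮-⋀ _ S₄∈𝒮 ((x , y , z) , refl)))

  ⊢-refl : ∀ {x} → x ⊢ x
  ⊢-refl {x} = ⊢-trans (𝒮-⋀ _ S₆∈𝒮 (x , refl)) (𝒮-⋀ _ S₇∈𝒮 (x , refl))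

  ⊢-preorder : Preorder c c c
  ⊢-preorder = record
    { Carrier = Carrier
    ; _≈_ = _≡_
    ; _≲_ = _⊢_
    ; isPreorder = record
      { isEquivalence = isEquivalence
      ; reflexive = λ { refl → ⊢-refl }
      ; trans = ⊢-trans
      }
    }

  open PreorderReasoning ⊢-preorder

  ≼⇒⊢ : ∀ {x y} → x ≼ y → x ⊢ y
  ≼⇒⊢ x≼y = 𝒮-upward ⊢-refl (⊥-antimono (⊗-mono ≼-refl (⊥-antimono x≼y)))

  contraposition : ∀ {x y} → x ⊢ y → y ⊥ ⊢ x ⊥
  contraposition = 𝒮-contra

  refutable-⊢ : ∀ {x y} → x ⊢ y → Refutable y → Refutable x
  refutable-⊢ x⊢y y-ref = 𝒮-mp y-ref (contraposition x⊢y)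

  ⊗-comm : ∀ x y → x ⊗ y ⊢ y ⊗ x
  ⊗-comm x y = 𝒮-⋀ _ S₃∈𝒮 ((x , y) , refl)

  ⊗-assoc : ∀ x y z → (x ⊗ y) ⊗ z ⊢ x ⊗ (y ⊗ z)
  ⊗-assoc x y z = 𝒮-⋀ _ S₅∈𝒮 ((x , y , z) , refl)

  ⊗-monoˡ : ∀ {x y} z → x ⊢ y → x ⊗ z ⊢ y ⊗ z
  ⊗-monoˡ = 𝒮-⊗

  ⊗-monoʳ : ∀ {y z} x → y ⊢ z → x ⊗ y ⊢ x ⊗ z
  ⊗-monoʳ {y} {z} x y⊢z = begin
    x ⊗ y  ∼⟨ ⊗-comm x y ⟩
    y ⊗ x  ∼⟨ ⊗-monoˡ x y⊢z ⟩
    z ⊗ x  ∼⟨ ⊗-comm z x ⟩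
    x ⊗ z  ∎

  ⊗-assoc⁻¹ : ∀ x y z → x ⊗ (y ⊗ z) ⊢ (x ⊗ y) ⊗ z
  ⊗-assoc⁻¹ x y z = begin
    x ⊗ (y ⊗ z)  ∼⟨ ⊗-comm x (y ⊗ z) ⟩
    (y ⊗ z) ⊗ x  ∼⟨ ⊗-assoc y z x ⟩
    y ⊗ (z ⊗ x)  ∼⟨ ⊗-comm y (z ⊗ x) ⟩
    (z ⊗ x) ⊗ y  ∼⟨ ⊗-assoc z x y ⟩
    z ⊗ (x ⊗ y)  ∼⟨ ⊗-comm z (x ⊗ y) ⟩
    (x ⊗ y) ⊗ z  ∎

  ⊗-swapˡ : ∀ x y z → x ⊗ (y ⊗ z) ⊢ y ⊗ (x ⊗ z)
  ⊗-swapˡ x y z = begin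
    x ⊗ (y ⊗ z)  ∼⟨ ⊗-assoc⁻¹ x y z ⟩
    (x ⊗ y) ⊗ z  ∼⟨ ⊗-monoˡ z (⊗-comm x y) ⟩
    (y ⊗ x) ⊗ z  ∼⟨ ⊗-assoc y x z ⟩
    y ⊗ (x ⊗ z)  ∎

  ⊗-swapʳ : ∀ x y z → (x ⊗ y) ⊗ z ⊢ (x ⊗ z) ⊗ y
  ⊗-swapʳ x y z = begin
    (x ⊗ y) ⊗ z  ∼⟨ ⊗-assoc x y z ⟩
    x ⊗ (y ⊗ z)  ∼⟨ ⊗-monoʳ x (⊗-comm y z) ⟩
    x ⊗ (z ⊗ y)  ∼⟨ ⊗-assoc⁻¹ x z y ⟩
    (x ⊗ z) ⊗ y  ∎

  ⊢-curry : ∀ {x y z} → x ⊗ y ⊢ z → x ⊢ y ⊸ z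
  ⊢-curry {x} {y} {z} = refutable-⊢ (begin
    x ⊗ (y ⊸ z) ⊥  ≡⟨ cong (x ⊗_) (⊥-involutive _) ⟩
    x ⊗ (y ⊗ z ⊥)  ∼⟨ ⊗-assoc⁻¹ x y (z ⊥) ⟩
    (x ⊗ y) ⊗ z ⊥  ∎)

  ⅋-⊥ : ∀ x y → (x ⅋ y) ⊥ ≡ x ⊥ ⊗ y ⊥
  ⅋-⊥ x y = ⊥-involutive _

  ⅋-monoʳ-≼ : ∀ {x y z} → y ≼ z → x ⅋ y ≼ x ⅋ z
  ⅋-monoʳ-≼ y≼z = ⊥-antimono (⊗-mono ≼-refl (⊥-antimono y≼z))

  ⅋-monoʳ : ∀ {x y z} → y ⊢ z → x ⅋ y ⊢ x ⅋ z
  ⅋-monoʳ {x} y⊢z = contraposition (⊗-monoʳ (x ⊥) (contraposition y⊢z))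

  ⅋-comm : ∀ x y → x ⅋ y ⊢ y ⅋ x
  ⅋-comm x y = contraposition (⊗-comm (y ⊥) (x ⊥))

  ⅋-swapˡ : ∀ x y z → x ⅋ (y ⅋ z) ⊢ y ⅋ (x ⅋ z)
  ⅋-swapˡ x y z = begin
    x ⅋ (y ⅋ z)                ≡⟨ cong (λ t → (x ⊥ ⊗ t) ⊥) (⅋-⊥ y z) ⟩
    (x ⊥ ⊗ (y ⊥ ⊗ z ⊥)) ⊥      ∼⟨ contraposition (⊗-swapˡ (y ⊥) (x ⊥) (z ⊥)) ⟩
    (y ⊥ ⊗ (x ⊥ ⊗ z ⊥)) ⊥      ≡⟨ cong (λ t → (y ⊥ ⊗ t) ⊥) (sym (⅋-⊥ x z)) ⟩
    y ⅋ (x ⅋ z)                ∎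

  ⅋-elimˡ : ∀ x y → (x ⅋ y) ⊗ x ⊥ ⊢ y
  ⅋-elimˡ x y = refutable-⊢ (⊢-trans (⊗-assoc (x ⅋ y) (x ⊥) (y ⊥)) (⊗-comm _ _)) ⊢-refl

  ⅋-elim-refutableˡ : ∀ {x y} → Refutable x → x ⅋ y ⊢ y
  ⅋-elim-refutableˡ {x} {y} =
    refutable-⊢ (⊢-trans (⊗-monoˡ (y ⊥) (⅋-comm x y)) (⅋-elimˡ y x))

  ⅋-⊗-distrib : ∀ x y z → (x ⅋ y) ⊗ z ⊢ x ⅋ (y ⊗ z)
  ⅋-⊗-distrib x y z = refutable-⊢ (begin
    ((x ⅋ y) ⊗ z) ⊗ (x ⅋ (y ⊗ z)) ⊥    ≡⟨ cong (((x ⅋ y) ⊗ z) ⊗_) (⅋-⊥ x (y ⊗ z)) ⟩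
    ((x ⅋ y) ⊗ z) ⊗ (x ⊥ ⊗ (y ⊗ z) ⊥)  ∼⟨ ⊗-assoc⁻¹ ((x ⅋ y) ⊗ z) (x ⊥) _ ⟩
    (((x ⅋ y) ⊗ z) ⊗ x ⊥) ⊗ (y ⊗ z) ⊥  ∼⟨ ⊗-monoˡ _ (⊗-swapʳ (x ⅋ y) z (x ⊥)) ⟩
    (((x ⅋ y) ⊗ x ⊥) ⊗ z) ⊗ (y ⊗ z) ⊥  ∎)
    (⊗-monoˡ z (⅋-elimˡ x y))

  ⊗-⅋-distrib : ∀ x y z → x ⊗ (y ⅋ z) ⊢ (x ⊗ y) ⅋ z
  ⊗-⅋-distrib x y z = begin
    x ⊗ (y ⅋ z)  ∼⟨ ⊗-comm x (y ⅋ z) ⟩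
    (y ⅋ z) ⊗ x  ∼⟨ ⊗-monoˡ x (⅋-comm y z) ⟩
    (z ⅋ y) ⊗ x  ∼⟨ ⅋-⊗-distrib z y x ⟩
    z ⅋ (y ⊗ x)  ∼⟨ ⅋-monoʳ (⊗-comm y x) ⟩
    z ⅋ (x ⊗ y)  ∼⟨ ⅋-comm z (x ⊗ y) ⟩
    (x ⊗ y) ⅋ z  ∎

  ⅋-⊗-intro : ∀ g a b d → (g ⅋ a) ⊗ (b ⅋ d) ⊢ g ⅋ ((a ⊗ b) ⅋ d)
  ⅋-⊗-intro g a b d = begin
    (g ⅋ a) ⊗ (b ⅋ d)    ∼⟨ ⅋-⊗-distrib g a (b ⅋ d) ⟩
    g ⅋ (a ⊗ (b ⅋ d))    ∼⟨ ⅋-monoʳ (⊗-⅋-distrib a b d) ⟩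
    g ⅋ ((a ⊗ b) ⅋ d)    ∎

  ⅋-cut : ∀ g a d → (g ⅋ a) ⊗ (a ⊥ ⅋ d) ⊢ g ⅋ d
  ⅋-cut g a d = begin
    (g ⅋ a) ⊗ (a ⊥ ⅋ d)  ∼⟨ ⅋-⊗-intro g a (a ⊥) d ⟩
    g ⅋ ((a ⊗ a ⊥) ⅋ d)  ∼⟨ ⅋-monoʳ (⅋-elim-refutableˡ (⊢-refl {a})) ⟩
    g ⅋ d                ∎

  ⅋ⁿ-cong : ∀ {n} {a b : Fin (suc n) → Carrier} → (∀ i → a i ≡ b i) → ⅋ⁿ a ≡ ⅋ⁿ b
  ⅋ⁿ-cong {zero} a≡b = a≡b fzero
  ⅋ⁿ-cong {suc n} a≡b = cong₂ _⅋_ (a≡b fzero) (⅋ⁿ-cong (a≡b ∘ fsuc))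

  ⅋ⁿ-pull : ∀ {n} (a : Fin (suc (suc n)) → Carrier) k → ⅋ⁿ a ⊢ a k ⅋ ⅋ⁿ (a ∘ punchIn k)
  ⅋ⁿ-pull a fzero = ⊢-refl
  ⅋ⁿ-pull {zero} a (fsuc fzero) = ⅋-comm _ _
  ⅋ⁿ-pull {suc n} a (fsuc k) = ⊢-trans (⅋-monoʳ (⅋ⁿ-pull (a ∘ fsuc) k)) (⅋-swapˡ _ _ _)

  ⅋ⁿ-permute : ∀ n (a : Fin (suc n) → Carrier) (σ : Permutation′ (suc n)) →
               ⅋ⁿ a ⊢ ⅋ⁿ (λ i → a (σ ⟨$⟩ʳ i))
  ⅋ⁿ-permute zero a σ with σ ⟨$⟩ʳ fzero
  ... | fzero = ⊢-refl
  ⅋ⁿ-permute (suc n) a σ = begin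
    ⅋ⁿ a                                ∼⟨ ⅋ⁿ-pull a k ⟩
    a k ⅋ ⅋ⁿ (a ∘ punchIn k)            ∼⟨ ⅋-monoʳ (⅋ⁿ-permute n (a ∘ punchIn k) σ′) ⟩
    a k ⅋ ⅋ⁿ (λ i → a (punchIn k (σ′ ⟨$⟩ʳ i)))
      ≡⟨ cong (a k ⅋_) (⅋ⁿ-cong (λ i → cong a (sym (punchIn-permute σ fzero i)))) ⟩
    ⅋ⁿ (λ i → a (σ ⟨$⟩ʳ i))             ∎
    where
    k = σ ⟨$⟩ʳ fzero
    σ′ = remove fzero σ

proposition3p17 : ∀ {c} (A : ConjunctiveAlgebra c) →
    let open ConjunctiveAlgebra A in
    (∀ a → 𝒮 (a ⊸ a))
    × (∀ n (a : Fin (Data.Nat.suc n) → Carrier) (σ : Permutation′ (Data.Nat.suc n)) →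
         𝒮 (⅋ⁿ a ⊸ ⅋ⁿ (λ i → a (σ ⟨$⟩ʳ i))))
    × (∀ a b g → (g ⅋ a ≼ g ⅋ (a ∨ b)) × 𝒮 ((g ⅋ a) ⊸ (g ⅋ (a ∨ b))))
    × (∀ a b g d →
         𝒮 ((g ⅋ a) ⊗ (b ⅋ d) ⊸ g ⅋ ((a ⊗ b) ⅋ d))
         × 𝒮 ((g ⅋ a) ⊸ (b ⅋ d) ⊸ g ⅋ ((a ⊗ b) ⅋ d)))
    × (∀ a g d → 𝒮 ((g ⅋ a) ⊸ ((a ⊥) ⅋ d) ⊸ (g ⅋ d)))
    × 𝒮 𝟏
    × (∀ g b (F : Carrier → Carrier) → g ⅋ F b ≼ g ⅋ ∃ᶜ F)
proposition3p17 A =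
    (λ a → ⊢-refl)
  , ⅋ⁿ-permute
  , (λ a b g → let g⅋a≼ = ⅋-monoʳ-≼ (⋁-upper _ a (inj₁ refl)) in g⅋a≼ , ≼⇒⊢ g⅋a≼)
  , (λ a b g d → ⅋-⊗-intro g a b d , ⊢-curry (⅋-⊗-intro g a b d))
  , (λ a g d → ⊢-curry (⅋-cut g a d))
  , 𝟏∈𝒮
  , (λ g b F → ⅋-monoʳ-≼ (⋁-upper _ (F b) (b , refl)))
  where
  open ConjunctiveAlgebra A
  open ConjunctiveAlgebraProperties A
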